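{- Let $(a_n)_{n=1}^\infty$ be a non-decreasing sequence of positive integers with $a_1\geqslant 2$ and $a_n\to\infty$. Suppose there exist a unique $\theta\in(0,1)$ and a unique sequence of positive integers $(b_n)_{n=1}^\infty$ such that $\sum_{n=1}^\infty\frac1{b_n}=\theta$ and $a_n=G\left(\theta-\sum_{i=1}^{n-1}\frac1{b_i}\right)$ for every $n\geqslant1$. Then for all $n\geqslant1$: $a_{n+1}\geqslant a_n+2$; $a_{n+1}-a_n$ does not divide $a_na_{n+1}$; and $$\left\lfloor\frac{a_n^2}{a_{n+1}-a_n}\right\rfloor<\frac{(a_n-1)^2}{a_{n+1}-a_n}.$$
   Context: For $x\in(0,1]$, $G(x)=\lfloor 1/x\rfloor+1$, i.e. the unique integer $a\geqslant 2$ with $\frac1a<x\leqslant\frac{1}{a-1}$. Empty sums are $0$. -}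

module Defs where

open import Data.Nat as ℕ using (ℕ; zero; suc; _∸_)
open import Data.Nat.DivMod using (_/_)
open import Data.Integer using (+_)
open import Data.Rational as ℚ using (ℚ; 0ℚ; 1ℚ)
open import Data.Product using (Σ; ∃; _×_)

-- reciprocal 1/m as a rational (junk value 0 at m = 0; only used for m ≥ 1)
recip : ℕ → ℚ
recip zero    = 0ℚ
recip (suc k) = (+ 1) ℚ./ suc k

-- finite block sum  Σ_{i = n}^{n+k-1} 1 / b i   (sequences indexed from 0)
block : (ℕ → ℕ) → ℕ → ℕ → ℚ
block b n zero    = 0ℚ
block b n (suc k) = recip (b n) ℚ.+ block b (suc n) k

-- floor division ⌊m/d⌋ (junk value 0 at d = 0; only used for d ≥ 2)
fdiv : ℕ → ℕ → ℕ
fdiv m zero    = 0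
fdiv m (suc k) = m / suc k

-- The real tail r_n(b) = Σ_{i ≥ n} 1/b i (a series of positive terms, equal to the
-- supremum of its block sums) satisfies G(r_n) = a, i.e. 1/a < r_n ≤ 1/(a-1):
--   1/a < r_n      ⇔  some block sum exceeds 1/a
--   r_n ≤ 1/(a-1)  ⇔  every block sum is ≤ 1/(a-1)
GTail : (ℕ → ℕ) → ℕ → ℕ → Set
GTail b n a = (∃ λ k → recip a ℚ.< block b n k) × (∀ k → block b n k ℚ.≤ recip (a ∸ 1))

-- θ = Σ_{i ≥ 0} 1/b i lies in (0,1): it is a sup of block sums, so θ < 1 iff
-- all block sums are bounded by some rational q < 1 (θ > 0 is automatic for positive b).
ThetaInUnit : (ℕ → ℕ) → Set
ThetaInUnit b = ∃ λ q → (q ℚ.< 1ℚ) × (∀ k → block b 0 k ℚ.≤ q)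

-- b is an admissible sequence for a: positive integers, θ := Σ 1/b i ∈ (0,1),
-- and a n = G(θ - Σ_{i<n} 1/b i) = G(Σ_{i≥n} 1/b i) for every n.
Admissible : (ℕ → ℕ) → (ℕ → ℕ) → Set
Admissible a b = (∀ i → 1 ℕ.≤ b i) × ThetaInUnit b × (∀ n → GTail b n (a n))

{-# OPTIONS --safe #-}
-- Write r n = Σ_{i ≥ n} 1 / b i. The unique sequence b is pinned down locally: if
-- 1/a m < 1/c + r (m+1) < 1/(a m − 1) then c = b m. Indeed, putting c at position m and
-- re-choosing the denominators at positions m−1, …, 0 yields another admissible sequence:
-- at each position start from a large denominator and decrease it until 1/a j is exceeded;
-- convexity of 1/x keeps the strict upper bound 1/(a j − 1) along the way.
-- Trying c = b n + 1 shows that a is strictly increasing and that r n < 1/(a n − 1).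
-- Now let E = a n − 1 and d = a (n+1) − a n. If E² ≤ k d ≤ (E+1)², then, since
-- 1/(E+1+d) < r (n+1) < 1/(E+d), both k + E and k + E + 1 fit at position n, which is absurd.
-- The claims follow with k = a n ² when d = 1 (d = 0 is already excluded), with k = a n ² / d
-- when d divides a n a (n+1) = a n ² + a n d, and with k = ⌊a n ² / d⌋.
-- The tails are only accessible through their partial sums, so the backwards construction is
-- carried out under double negation; this suffices since equality of naturals is decidable.
module Submission where

open import Data.Empty using (⊥)
open import Data.Integer as ℤ using (+_)
import Data.Integer.Properties as ℤP
open import Data.List using (_∷_; [])
open import Data.Nat using (ℕ; zero; suc; _+_; _*_; _∸_; _^_; _≤_; _<_; z≤n; s≤s; _≟_; _<?_)
open import Data.Nat.Divisibility using (_∣_; divides; ∣m+n∣m⇒∣n; n∣m*n)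
open import Data.Nat.DivMod using (m/n*n≤m)
import Data.Nat.Properties as ℕP
open import Data.Nat.Properties
  using (≤-refl; ≤-reflexive; ≤-trans; <⇒≤; ≮⇒≥; >⇒≢; ≤∧≢⇒<; 1+n≢n; n≤1+n; n<1+n; m≤m+n; m≤n+m;
         m≤n⇒m<n∨m≡n; m<n⇒0<n∸m; m+[n∸m]≡n; m∸n≤m; ∸-monoˡ-≤; +-comm; +-monoʳ-≤; +-monoˡ-≤;
         +-monoʳ-<; *-monoʳ-<; *-monoʳ-≤; *-monoˡ-≤; *-mono-≤; *-identityˡ; *-identityʳ;
         *-distribˡ-+; ^-monoˡ-≤)
open import Data.Nat.Tactic.RingSolver using (solve)
open import Data.Product using (∃; _×_; _,_; proj₁; proj₂)
open import Data.Rational as ℚ using (ℚ; 0ℚ; toℚᵘ)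
import Data.Rational.Properties as ℚP
open import Data.Rational.Solver using (module +-*-Solver)
open +-*-Solver using (_:+_; _:-_; _:=_) renaming (solve to solveℚ)
open import Data.Rational.Unnormalised as ℚᵘ using (ℚᵘ; mkℚᵘ; *≡*; *≤*; *<*)
import Data.Rational.Unnormalised.Properties as ℚᵘP
open import Data.Sum using (inj₁; inj₂)
open import Effect.Monad using (RawMonad)
open import Function using (_∘_)
open import Level using (0ℓ)
open import Relation.Binary.PropositionalEquality
  using (_≡_; _≢_; _≗_; refl; sym; trans; cong; cong₂; subst; subst₂; module ≡-Reasoning)
open import Relation.Nullary using (¬_; yes; no; contradiction)
open import Relation.Nullary.Decidable using (decidable-stable; ¬¬-excluded-middle)
open import Relation.Nullary.Negation using (¬¬-Monad)

open import Defs

open RawMonad (¬¬-Monad {0ℓ}) using (pure; _>>=_)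

-- p / q, for q ≥ 1
fraction : ℕ → ℕ → ℚᵘ
fraction p q = mkℚᵘ (+ p) (q ∸ 1)

fraction-≤ : ∀ {p q r s} → 1 ≤ q → 1 ≤ s → p * s ≤ r * q → fraction p q ℚᵘ.≤ fraction r s
fraction-≤ {p} {suc q} {r} {suc s} _ _ ps≤rq =
  *≤* (subst₂ ℤ._≤_ (ℤP.pos-* p (suc s)) (ℤP.pos-* r (suc q)) (ℤ.+≤+ ps≤rq))

fraction-< : ∀ {p q r s} → 1 ≤ q → 1 ≤ s → p * s < r * q → fraction p q ℚᵘ.< fraction r s
fraction-< {p} {suc q} {r} {suc s} _ _ ps<rq =
  *<* (subst₂ ℤ._<_ (ℤP.pos-* p (suc s)) (ℤP.pos-* r (suc q)) (ℤ.+<+ ps<rq))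

toℚᵘ-recip : ∀ m → 1 ≤ m → toℚᵘ (recip m) ℚᵘ.≃ fraction 1 m
toℚᵘ-recip (suc m) _ = ℚP.toℚᵘ-fromℚᵘ (mkℚᵘ (+ 1) m)

toℚᵘ-recip-+ : ∀ m n → 1 ≤ m → 1 ≤ n → toℚᵘ (recip m ℚ.+ recip n) ℚᵘ.≃ fraction (m + n) (m * n)
toℚᵘ-recip-+ (suc m) (suc n) m≥1 n≥1 = ℚᵘP.≃-trans (ℚP.toℚᵘ-homo-+ (recip (suc m)) (recip (suc n)))
  (ℚᵘP.≃-trans (ℚᵘP.+-cong (toℚᵘ-recip (suc m) m≥1) (toℚᵘ-recip (suc n) n≥1))
               (*≡* (cong +_ (solve (m ∷ n ∷ [])))))

toℚᵘ-reflect-≤ : ∀ {p q x y} → toℚᵘ p ℚᵘ.≃ x → toℚᵘ q ℚᵘ.≃ y → x ℚᵘ.≤ y → p ℚ.≤ q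
toℚᵘ-reflect-≤ p≃x q≃y x≤y =
  ℚP.toℚᵘ-cancel-≤ (ℚᵘP.≤-respˡ-≃ (ℚᵘP.≃-sym p≃x) (ℚᵘP.≤-respʳ-≃ (ℚᵘP.≃-sym q≃y) x≤y))

toℚᵘ-reflect-< : ∀ {p q x y} → toℚᵘ p ℚᵘ.≃ x → toℚᵘ q ℚᵘ.≃ y → x ℚᵘ.< y → p ℚ.< q
toℚᵘ-reflect-< p≃x q≃y x<y =
  ℚP.toℚᵘ-cancel-< (ℚᵘP.<-respˡ-≃ (ℚᵘP.≃-sym p≃x) (ℚᵘP.<-respʳ-≃ (ℚᵘP.≃-sym q≃y) x<y))

recip-nonneg : ∀ n → 0ℚ ℚ.≤ recip n
recip-nonneg zero    = ℚP.≤-refl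
recip-nonneg (suc n) = toℚᵘ-reflect-≤ {x = fraction 0 1} ℚᵘP.≃-refl (toℚᵘ-recip (suc n) (s≤s z≤n))
  (fraction-≤ (s≤s z≤n) (s≤s z≤n) z≤n)

recip-antitone-≤ : ∀ {m n} → 1 ≤ m → m ≤ n → recip n ℚ.≤ recip m
recip-antitone-≤ {m} {n} m≥1 m≤n = let n≥1 = ≤-trans m≥1 m≤n in
  toℚᵘ-reflect-≤ (toℚᵘ-recip n n≥1) (toℚᵘ-recip m m≥1) (fraction-≤ n≥1 m≥1 (*-monoʳ-≤ 1 m≤n))

recip-antitone-< : ∀ {m n} → 1 ≤ m → m < n → recip n ℚ.< recip m
recip-antitone-< {m} {n} m≥1 m<n = let n≥1 = ≤-trans m≥1 (<⇒≤ m<n) in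
  toℚᵘ-reflect-< (toℚᵘ-recip n n≥1) (toℚᵘ-recip m m≥1) (fraction-< n≥1 m≥1 (*-monoʳ-< 1 m<n))

recip-archimedean : ∀ {ε} → 0ℚ ℚ.< ε → ∃ λ N → recip (suc N) ℚ.< ε
recip-archimedean {ℚ.mkℚ ℤ.+[1+ n ] d _} _ = suc d ,
  toℚᵘ-reflect-< (toℚᵘ-recip (suc (suc d)) (s≤s z≤n)) ℚᵘP.≃-refl
    (fraction-< (s≤s z≤n) (s≤s z≤n) (subst (_< suc n * suc (suc d)) (sym (*-identityˡ (suc d)))
      (ℕP.<-≤-trans (n<1+n (suc d)) (ℕP.m≤n*m (suc (suc d)) (suc n)))))
recip-archimedean {ℚ.mkℚ (+ 0) d _}      (ℚ.*<* (ℤ.+<+ ()))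
recip-archimedean {ℚ.mkℚ ℤ.-[1+ n ] d _} (ℚ.*<* ())

recip-+-recip-≤-recip : ∀ x y z → 1 ≤ x → 1 ≤ y → 1 ≤ z → (x + y) * z ≤ x * y
                      → recip x ℚ.+ recip y ℚ.≤ recip z
recip-+-recip-≤-recip x y z x≥1 y≥1 z≥1 [x+y]z≤xy =
  toℚᵘ-reflect-≤ (toℚᵘ-recip-+ x y x≥1 y≥1) (toℚᵘ-recip z z≥1)
    (fraction-≤ (*-mono-≤ x≥1 y≥1) z≥1 (subst ((x + y) * z ≤_) (sym (*-identityˡ (x * y))) [x+y]z≤xy))

recip-≤-recip-+-recip : ∀ x y z → 1 ≤ x → 1 ≤ y → 1 ≤ z → x * y ≤ (x + y) * z
                      → recip z ℚ.≤ recip x ℚ.+ recip y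
recip-≤-recip-+-recip x y z x≥1 y≥1 z≥1 xy≤[x+y]z =
  toℚᵘ-reflect-≤ (toℚᵘ-recip z z≥1) (toℚᵘ-recip-+ x y x≥1 y≥1)
    (fraction-≤ z≥1 (*-mono-≤ x≥1 y≥1) (subst (_≤ (x + y) * z) (sym (*-identityˡ (x * y))) xy≤[x+y]z))

recip-+-recip-< : ∀ x y z w → 1 ≤ x → 1 ≤ y → 1 ≤ z → 1 ≤ w → (x + y) * (z * w) < (z + w) * (x * y)
                → recip x ℚ.+ recip y ℚ.< recip z ℚ.+ recip w
recip-+-recip-< x y z w x≥1 y≥1 z≥1 w≥1 lt =
  toℚᵘ-reflect-< (toℚᵘ-recip-+ x y x≥1 y≥1) (toℚᵘ-recip-+ z w z≥1 w≥1)
    (fraction-< (*-mono-≤ x≥1 y≥1) (*-mono-≤ z≥1 w≥1) lt)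

recip-+-spread-< : ∀ {A c} → 2 ≤ A → A ≤ c → recip A ℚ.+ recip c ℚ.< recip (A ∸ 1) ℚ.+ recip (suc c)
recip-+-spread-< {suc E} {c} (s≤s E≥1) E<c =
  recip-+-recip-< (suc E) c E (suc c) (s≤s z≤n) (≤-trans (s≤s z≤n) E<c) E≥1 (s≤s z≤n) (begin-strict
    (suc E + c) * (E * suc c)  ≡⟨ solve (E ∷ c ∷ []) ⟩
    suc (E + c) * (E * c + E)  <⟨ *-monoʳ-< (suc (E + c)) (+-monoʳ-< (E * c) E<c) ⟩
    suc (E + c) * (E * c + c)  ≡⟨ solve (E ∷ c ∷ []) ⟩
    (E + suc c) * (suc E * c)  ∎)
  where open ℕP.≤-Reasoning

1/A≤1/c+1/[A+d] : ∀ {A c d} → 1 ≤ A → 1 ≤ c → c * d ≤ A * (A + d) → recip A ℚ.≤ recip c ℚ.+ recip (A + d)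
1/A≤1/c+1/[A+d] {A} {c} {d} A≥1 c≥1 cd≤A[A+d] =
  recip-≤-recip-+-recip c (A + d) A c≥1 (≤-trans A≥1 (m≤m+n A d)) A≥1 (begin
    c * (A + d)          ≡⟨ solve (c ∷ A ∷ d ∷ []) ⟩
    c * A + c * d        ≤⟨ +-monoʳ-≤ (c * A) cd≤A[A+d] ⟩
    c * A + A * (A + d)  ≡⟨ solve (c ∷ A ∷ d ∷ []) ⟩
    (c + (A + d)) * A    ∎)
  where open ℕP.≤-Reasoning

1/[k+E]+1/[E+d]≤1/E : ∀ {E k d} → 1 ≤ E → E * E ≤ k * d → recip (k + E) ℚ.+ recip (E + d) ℚ.≤ recip E
1/[k+E]+1/[E+d]≤1/E {E} {k} {d} E≥1 E²≤kd =
  recip-+-recip-≤-recip (k + E) (E + d) E (≤-trans E≥1 (m≤n+m E k)) (≤-trans E≥1 (m≤m+n E d)) E≥1 (begin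
    (k + E + (E + d)) * E            ≡⟨ solve (E ∷ k ∷ d ∷ []) ⟩
    (k * E + E * E + E * d) + E * E  ≤⟨ +-monoʳ-≤ (k * E + E * E + E * d) E²≤kd ⟩
    (k * E + E * E + E * d) + k * d  ≡⟨ solve (E ∷ k ∷ d ∷ []) ⟩
    (k + E) * (E + d)                ∎)
  where open ℕP.≤-Reasoning

p+q≡[r+q]+[p-r] : ∀ p q r → p ℚ.+ q ≡ (r ℚ.+ q) ℚ.+ (p ℚ.- r)
p+q≡[r+q]+[p-r] = solveℚ 3 (λ p q r → p :+ q := (r :+ q) :+ (p :- r)) refl

p+q<r+s⇒p+[q-s]<r : ∀ {p q r s} → p ℚ.+ q ℚ.< r ℚ.+ s → p ℚ.+ (q ℚ.- s) ℚ.< r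
p+q<r+s⇒p+[q-s]<r {p} {q} {r} {s} lt = subst₂ ℚ._<_
  (solveℚ 3 (λ p q s → (p :+ q) :- s := p :+ (q :- s)) refl p q s)
  (solveℚ 2 (λ r s → (r :+ s) :- s := r) refl r s)
  (ℚP.+-monoˡ-< (ℚ.- s) lt)

p<q-r⇒p+r<q : ∀ {p q r} → p ℚ.< q ℚ.- r → p ℚ.+ r ℚ.< q
p<q-r⇒p+r<q {p} {q} {r} lt =
  subst (p ℚ.+ r ℚ.<_) (solveℚ 2 (λ q r → (q :- r) :+ r := q) refl q r) (ℚP.+-monoˡ-< r lt)

p<q⇒0<q-p : ∀ {p q} → p ℚ.< q → 0ℚ ℚ.< q ℚ.- p
p<q⇒0<q-p {p} {q} lt = subst (ℚ._< q ℚ.- p) (ℚP.+-inverseʳ p) (ℚP.+-monoˡ-< (ℚ.- p) lt)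

-- A sequence s of partial sums stands for its supremum Σ, the sum of a series of
-- nonnegative terms: q <sup s, sup s ≤ u and sup s < u say q < Σ, Σ ≤ u and Σ < u.
infix 4 _<sup_ sup_≤_ sup_<_
infixr 6 _+ˢ_

_<sup_ : ℚ → (ℕ → ℚ) → Set
q <sup s = ∃ λ k → q ℚ.< s k

sup_≤_ : (ℕ → ℚ) → ℚ → Set
sup s ≤ u = ∀ k → s k ℚ.≤ u

sup_<_ : (ℕ → ℚ) → ℚ → Set
sup s < u = ∃ λ q → q ℚ.< u × sup s ≤ q

_+ˢ_ : ℚ → (ℕ → ℚ) → ℕ → ℚ
(x +ˢ s) k = x ℚ.+ s k

module _ {s t : ℕ → ℚ} (s≗t : s ≗ t) where

  <sup-cong : ∀ {q} → q <sup s → q <sup t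
  <sup-cong (k , q<sₖ) = k , subst (_ ℚ.<_) (s≗t k) q<sₖ

  sup-≤-cong : ∀ {u} → sup s ≤ u → sup t ≤ u
  sup-≤-cong s≤u k = subst (ℚ._≤ _) (s≗t k) (s≤u k)

  sup-<-cong : ∀ {u} → sup s < u → sup t < u
  sup-<-cong (q , q<u , s≤q) = q , q<u , sup-≤-cong s≤q

module _ {s : ℕ → ℚ} where

  sup-<⇒sup-≤ : ∀ {u} → sup s < u → sup s ≤ u
  sup-<⇒sup-≤ (q , q<u , s≤q) k = ℚP.≤-trans (s≤q k) (ℚP.<⇒≤ q<u)

  sup-<-≤-trans : ∀ {u v} → sup s < u → u ℚ.≤ v → sup s < v
  sup-<-≤-trans (q , q<u , s≤q) u≤v = q , ℚP.<-≤-trans q<u u≤v , s≤q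

  ≮sup⇒sup-≤ : ∀ {q} → ¬ (q <sup s) → sup s ≤ q
  ≮sup⇒sup-≤ q≮s k = ℚP.≮⇒≥ (λ q<sₖ → q≮s (k , q<sₖ))

  <sup⇒¬sup-≤ : ∀ {q} → q <sup s → ¬ (sup s ≤ q)
  <sup⇒¬sup-≤ (k , q<sₖ) s≤q = ℚP.<-irrefl refl (ℚP.<-≤-trans q<sₖ (s≤q k))

  <sup-+ˢ : ∀ {x y z} → x ℚ.≤ y ℚ.+ z → z <sup s → x <sup y +ˢ s
  <sup-+ˢ {y = y} x≤y+z (k , z<sₖ) = k , ℚP.≤-<-trans x≤y+z (ℚP.+-monoʳ-< y z<sₖ)

  <sup-+ˢ-of-≤ : ∀ {x y} → x ℚ.≤ y → 0ℚ <sup s → x <sup y +ˢ s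
  <sup-+ˢ-of-≤ {x} {y} x≤y = <sup-+ˢ {y = y} (subst (x ℚ.≤_) (sym (ℚP.+-identityʳ y)) x≤y)

  <sup-+ˢ-of-nonneg : ∀ {y z} → 0ℚ ℚ.≤ y → z <sup s → z <sup y +ˢ s
  <sup-+ˢ-of-nonneg {y} {z} 0≤y =
    <sup-+ˢ {y = y} (subst (ℚ._≤ y ℚ.+ z) (ℚP.+-identityˡ z) (ℚP.+-monoˡ-≤ z 0≤y))

  sup-≤-+ˢ : ∀ {x u} → sup s ≤ u → sup x +ˢ s ≤ x ℚ.+ u
  sup-≤-+ˢ {x} s≤u k = ℚP.+-monoʳ-≤ x (s≤u k)

  sup-<-+ˢ : ∀ {x u} → sup s < u → sup x +ˢ s < x ℚ.+ u
  sup-<-+ˢ {x} (q , q<u , s≤q) = x ℚ.+ q , ℚP.+-monoʳ-< x q<u , sup-≤-+ˢ {x = x} s≤q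

  sup-≤-+ˢ-exchange : ∀ {x y u} → sup x +ˢ s ≤ u → sup y +ˢ s ≤ u ℚ.+ (y ℚ.- x)
  sup-≤-+ˢ-exchange {x} {y} {u} x+s≤u k =
    subst (ℚ._≤ u ℚ.+ (y ℚ.- x)) (sym (p+q≡[r+q]+[p-r] y (s k) x)) (ℚP.+-monoˡ-≤ (y ℚ.- x) (x+s≤u k))

  sup-<-shrink-head : ∀ {x y u} → y ℚ.< x → sup x +ˢ s ≤ u → sup y +ˢ s < u
  sup-<-shrink-head {x} {y} {u} y<x x+s≤u =
    u ℚ.+ (y ℚ.- x) ,
    p+q<r+s⇒p+[q-s]<r {u} {y} {u} {x} (ℚP.+-monoʳ-< u y<x) ,
    sup-≤-+ˢ-exchange {x} {y} x+s≤u

  sup-<-archimedean : ∀ {u} → sup s < u → ∃ λ N → sup recip (suc N) +ˢ s < u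
  sup-<-archimedean (q , q<u , s≤q) with recip-archimedean (p<q⇒0<q-p q<u)
  ... | N , 1/[N+1]<u-q = N , _ , p<q-r⇒p+r<q 1/[N+1]<u-q , sup-≤-+ˢ {x = recip (suc N)} s≤q

-- c can be the denominator at a position n with a n = A, when s sums the tail after n.
-- The upper bound is strict so that the earlier denominators can still be chosen.
Fits : ℕ → (ℕ → ℚ) → ℕ → Set
Fits A s c = recip A <sup recip c +ˢ s × sup recip c +ˢ s < recip (A ∸ 1)

sup-<-next-denominator : ∀ {A c s} → 2 ≤ A → A ≤ c → sup recip (suc c) +ˢ s ≤ recip A
                       → sup recip c +ˢ s < recip (A ∸ 1)
sup-<-next-denominator {A} {c} A≥2 A≤c 1/[c+1]+s≤1/A =
  recip A ℚ.+ (recip c ℚ.- recip (suc c)) ,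
  p+q<r+s⇒p+[q-s]<r {recip A} {recip c} (recip-+-spread-< A≥2 A≤c) ,
  sup-≤-+ˢ-exchange {x = recip (suc c)} {recip c} 1/[c+1]+s≤1/A

-- Decrease c until it fits; whether c fits is not decidable, hence the double negation.
fit-exists : ∀ {A s} c → 2 ≤ A → 0ℚ <sup s → 1 ≤ c → sup recip c +ˢ s < recip (A ∸ 1)
           → ¬ ¬ ∃ λ c → 1 ≤ c × Fits A s c
fit-exists {A} (suc c) A≥2 s>0 c+1≥1 below with c <? A
... | yes c<A = pure (suc c , c+1≥1 , <sup-+ˢ-of-≤ (recip-antitone-≤ c+1≥1 c<A) s>0 , below)
... | no c≮A = do
  yes above ← ¬¬-excluded-middle
    where no ¬above → fit-exists c A≥2 s>0 (≤-trans (≤-trans (s≤s z≤n) A≥2) (≮⇒≥ c≮A))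
                        (sup-<-next-denominator A≥2 (≮⇒≥ c≮A) (≮sup⇒sup-≤ ¬above))
  pure (suc c , c+1≥1 , above , below)

consecutive-fits : ∀ {E d k s} → 1 ≤ E → E * E ≤ k * d → k * d ≤ suc E * suc E
                 → recip (suc E + d) <sup s → sup s < recip (E + d)
                 → Fits (suc E) s (k + E) × Fits (suc E) s (suc (k + E))
consecutive-fits {E} {d} {k} {s} E≥1 E²≤kd kd≤A² above below =
  (above-for {c} c≥1 cd≤A[A+d] , below-c) , (above-for {suc c} (s≤s z≤n) [c+1]d≤A[A+d] , below-c+1)
  where
  A = suc E
  c = k + E
  c≥1 : 1 ≤ c
  c≥1 = ≤-trans E≥1 (m≤n+m E k)
  [c+1]d≤A[A+d] : suc c * d ≤ A * (A + d)
  [c+1]d≤A[A+d] = begin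
    suc (k + E) * d            ≡⟨ solve (E ∷ d ∷ k ∷ []) ⟩
    k * d + suc E * d          ≤⟨ +-monoˡ-≤ (suc E * d) kd≤A² ⟩
    suc E * suc E + suc E * d  ≡⟨ solve (E ∷ d ∷ []) ⟩
    suc E * (suc E + d)        ∎
    where open ℕP.≤-Reasoning
  cd≤A[A+d] : c * d ≤ A * (A + d)
  cd≤A[A+d] = ≤-trans (*-monoˡ-≤ d {c} {suc c} (n≤1+n c)) [c+1]d≤A[A+d]
  above-for : ∀ {c′} → 1 ≤ c′ → c′ * d ≤ A * (A + d) → recip A <sup recip c′ +ˢ s
  above-for {c′} c′≥1 c′d≤A[A+d] =
    <sup-+ˢ {y = recip c′} (1/A≤1/c+1/[A+d] {A} {c′} {d} (s≤s z≤n) c′≥1 c′d≤A[A+d]) above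
  below-c : sup recip c +ˢ s < recip E
  below-c = sup-<-≤-trans (sup-<-+ˢ {x = recip c} below) (1/[k+E]+1/[E+d]≤1/E {E} {k} {d} E≥1 E²≤kd)
  below-c+1 : sup recip (suc c) +ˢ s < recip E
  below-c+1 = sup-<-shrink-head {x = recip c} (recip-antitone-< c≥1 (n<1+n c)) (sup-<⇒sup-≤ below-c)

block-cong : ∀ {f g} n → (∀ i → n ≤ i → f i ≡ g i) → block f n ≗ block g n
block-cong n f≡g zero    = refl
block-cong n f≡g (suc k) =
  cong₂ ℚ._+_ (cong recip (f≡g n ≤-refl)) (block-cong (suc n) (λ i n<i → f≡g i (<⇒≤ n<i)) k)

GTail-cong : ∀ {f g n A} → (∀ i → n ≤ i → f i ≡ g i) → GTail f n A → GTail g n A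
GTail-cong {n = n} f≡g (above , below) =
  <sup-cong (block-cong n f≡g) above , sup-≤-cong (block-cong n f≡g) below

GTail-positive : ∀ {f n A} → GTail f n A → 0ℚ <sup block f n
GTail-positive {A = A} ((k , 1/A<sₖ) , _) = k , ℚP.≤-<-trans (recip-nonneg A) 1/A<sₖ

sup-<-block : ∀ {f n u} → sup block f n ∘ suc < u → sup block f n < u
sup-<-block {f} {n} (q , q<u , s≤q) = q , q<u , λ where
  zero    → ℚP.≤-trans (subst (0ℚ ℚ.≤_) (sym (ℚP.+-identityʳ (recip (f n)))) (recip-nonneg (f n)))
                        (s≤q 0)
  (suc k) → s≤q k

_[_]≔_ : (ℕ → ℕ) → ℕ → ℕ → ℕ → ℕ
(f [ j ]≔ c) i with i ≟ j
... | yes _ = c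
... | no _  = f i

[]≔-same : ∀ f j c → (f [ j ]≔ c) j ≡ c
[]≔-same f j c with j ≟ j
... | yes _  = refl
... | no j≢j = contradiction refl j≢j

[]≔-other : ∀ f {i j} c → i ≢ j → (f [ j ]≔ c) i ≡ f i
[]≔-other f {i} {j} c i≢j with i ≟ j
... | yes i≡j = contradiction i≡j i≢j
... | no _    = refl

m^2≡m*m : ∀ m → m ^ 2 ≡ m * m
m^2≡m*m m = cong (m *_) (*-identityʳ m)

fdiv-*-≤ : ∀ m d → fdiv m d * d ≤ m
fdiv-*-≤ m zero    = z≤n
fdiv-*-≤ m (suc d) = m/n*n≤m m (suc d)

module Realisations (a : ℕ → ℕ) (a≥2 : ∀ n → 2 ≤ a n) (a-mono : ∀ n → a n ≤ a (suc n)) where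

  Realises : ℕ → (ℕ → ℕ) → Set
  Realises j f = ∀ n → j ≤ n → 1 ≤ f n × GTail f n (a n)

  realises-update : ∀ {j f c} → Realises (suc j) f → 1 ≤ c → Fits (a j) (block f (suc j)) c
                  → Realises j (f [ j ]≔ c) × sup block (f [ j ]≔ c) j < recip (a j ∸ 1)
  realises-update {j} {f} {c} real c≥1 (above , below) = real′ , below′
    where
    f′ = f [ j ]≔ c
    agree : ∀ i → suc j ≤ i → f′ i ≡ f i
    agree i j<i = []≔-other f c (>⇒≢ j<i)
    head : recip c +ˢ block f (suc j) ≗ block f′ j ∘ suc
    head k = cong₂ ℚ._+_ (cong recip (sym ([]≔-same f j c)))
                         (block-cong (suc j) (λ i j<i → sym (agree i j<i)) k)
    below′ : sup block f′ j < recip (a j ∸ 1)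
    below′ = sup-<-block (sup-<-cong head below)
    real′ : Realises j f′
    real′ n j≤n with m≤n⇒m<n∨m≡n j≤n
    ... | inj₁ j<n = subst (1 ≤_) (sym (agree n j<n)) (proj₁ (real n j<n)) ,
                     GTail-cong {A = a n} (λ i n≤i → sym (agree i (≤-trans j<n n≤i)))
                                          (proj₂ (real n j<n))
    ... | inj₂ refl = subst (1 ≤_) (sym ([]≔-same f j c)) c≥1 ,
                      (let (k , lo) = <sup-cong head above in suc k , lo) , sup-<⇒sup-≤ below′

  fit-exists-before : ∀ {j f} → Realises (suc j) f → sup block f (suc j) < recip (a (suc j) ∸ 1)
                    → ¬ ¬ ∃ λ c → 1 ≤ c × Fits (a j) (block f (suc j)) c
  fit-exists-before {j} {f} real below =
    let (N , start) = sup-<-archimedean {tail} (sup-<-≤-trans {tail} below 1/[aⱼ₊₁-1]≤1/[aⱼ-1])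
    in fit-exists {a j} {tail} (suc N) (a≥2 j) tail>0 (s≤s z≤n) start
    where
    tail = block f (suc j)
    tail>0 : 0ℚ <sup tail
    tail>0 = GTail-positive {f} {suc j} {a (suc j)} (proj₂ (real (suc j) ≤-refl))
    1/[aⱼ₊₁-1]≤1/[aⱼ-1] : recip (a (suc j) ∸ 1) ℚ.≤ recip (a j ∸ 1)
    1/[aⱼ₊₁-1]≤1/[aⱼ-1] = recip-antitone-≤ (∸-monoˡ-≤ 1 (a≥2 j)) (∸-monoˡ-≤ 1 (a-mono j))

  realisation-extends-to-start : ∀ j {f} → Realises j f → sup block f j < recip (a j ∸ 1)
    → ¬ ¬ ∃ λ g → Realises 0 g × sup block g 0 < recip (a 0 ∸ 1) × (∀ i → j ≤ i → g i ≡ f i)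
  realisation-extends-to-start zero    {f} real below = pure (f , real , below , λ _ _ → refl)
  realisation-extends-to-start (suc j) {f} real below = do
    (c , c≥1 , fits) ← fit-exists-before real below
    let (real′ , below′) = realises-update real c≥1 fits
    (g , real-g , below-g , g≡f′) ← realisation-extends-to-start j real′ below′
    pure (g , real-g , below-g , λ i j<i → trans (g≡f′ i (<⇒≤ j<i)) ([]≔-other f c (>⇒≢ j<i)))

  realisation-admissible : ∀ {g} → Realises 0 g → sup block g 0 < recip (a 0 ∸ 1) → Admissible a g
  realisation-admissible real below =
    (λ i → proj₁ (real i z≤n)) ,
    sup-<-≤-trans below (recip-antitone-≤ ≤-refl (∸-monoˡ-≤ 1 (a≥2 0))) ,
    (λ n → proj₂ (real n z≤n))

  module UniqueExpansion (b : ℕ → ℕ) (adm : Admissible a b)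
                         (unique : ∀ b′ → Admissible a b′ → ∀ i → b′ i ≡ b i) where

    b≥1 : ∀ j → 1 ≤ b j
    b≥1 = proj₁ adm

    b-tail : ∀ j → GTail b j (a j)
    b-tail = proj₂ (proj₂ adm)

    fits⇒≡b : ∀ {m} c → 1 ≤ c → Fits (a m) (block b (suc m)) c → c ≡ b m
    fits⇒≡b {m} c c≥1 fits = decidable-stable (c ≟ b m) do
      let (real , below) = realises-update (λ n _ → b≥1 n , b-tail n) c≥1 fits
      (g , real-g , below-g , g≡b′) ← realisation-extends-to-start m real below
      pure (begin
        c              ≡⟨ sym ([]≔-same b m c) ⟩
        (b [ m ]≔ c) m ≡⟨ sym (g≡b′ m ≤-refl) ⟩
        g m            ≡⟨ unique g (realisation-admissible real-g below-g) m ⟩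
        b m            ∎)
      where open ≡-Reasoning

    b+1-sup-< : ∀ j → sup recip (suc (b j)) +ˢ block b (suc j) < recip (a j ∸ 1)
    b+1-sup-< j =
      sup-<-shrink-head {x = recip (b j)} (recip-antitone-< (b≥1 j) (n<1+n (b j)))
                                          (proj₂ (b-tail j) ∘ suc)

    b+1-≮sup : ∀ j → ¬ (recip (a j) <sup recip (suc (b j)) +ˢ block b (suc j))
    b+1-≮sup j above = 1+n≢n (fits⇒≡b (suc (b j)) (s≤s z≤n) (above , b+1-sup-< j))

    a-strictly-increasing : ∀ n → a n < a (suc n)
    a-strictly-increasing n with m≤n⇒m<n∨m≡n (a-mono n)
    ... | inj₁ aₙ<aₙ₊₁ = aₙ<aₙ₊₁
    ... | inj₂ aₙ≡aₙ₊₁ = contradiction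
      (<sup-+ˢ-of-nonneg (recip-nonneg (suc (b n)))
        (subst (λ A → recip A <sup block b (suc n)) (sym aₙ≡aₙ₊₁) (proj₁ (b-tail (suc n)))))
      (b+1-≮sup n)

    tail-sup-< : ∀ j → sup block b j < recip (a j ∸ 1)
    tail-sup-< j with b j <? a j
    ... | no bⱼ≮aⱼ = sup-<-block (sup-<-next-denominator (a≥2 j) (≮⇒≥ bⱼ≮aⱼ) (≮sup⇒sup-≤ (b+1-≮sup j)))
    ... | yes bⱼ<aⱼ = contradiction (proj₂ (b-tail j) ∘ suc) (<sup⇒¬sup-≤
      (<sup-+ˢ-of-≤ {x = recip (a j ∸ 1)} {recip (b j)} (recip-antitone-≤ (b≥1 j) (∸-monoˡ-≤ 1 bⱼ<aⱼ))
        (GTail-positive {b} {suc j} {a (suc j)} (b-tail (suc j)))))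

    gap : ℕ → ℕ
    gap n = a (suc n) ∸ a n

    a-suc≡a+gap : ∀ n → a (suc n) ≡ a n + gap n
    a-suc≡a+gap n = sym (m+[n∸m]≡n (a-mono n))

    no-multiple-in-window : ∀ n k → (a n ∸ 1) ^ 2 ≤ k * gap n → k * gap n ≤ a n ^ 2 → ⊥
    no-multiple-in-window n k lower upper =
      1+n≢n (trans (fits⇒≡b (suc (k + E)) (s≤s z≤n) (fit-at (suc (k + E)) (proj₂ fits)))
                   (sym (fits⇒≡b (k + E) c≥1 (fit-at (k + E) (proj₁ fits)))))
      where
      E = a n ∸ 1
      aₙ≡1+E : a n ≡ suc E
      aₙ≡1+E = sym (m+[n∸m]≡n (≤-trans (s≤s z≤n) (a≥2 n)))
      aₙ₊₁≡1+E+gap : a (suc n) ≡ suc E + gap n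
      aₙ₊₁≡1+E+gap = trans (a-suc≡a+gap n) (cong (_+ gap n) aₙ≡1+E)
      E≥1 : 1 ≤ E
      E≥1 = ∸-monoˡ-≤ 1 (a≥2 n)
      c≥1 : 1 ≤ k + E
      c≥1 = ≤-trans E≥1 (m≤n+m E k)
      s = block b (suc n)
      fits : Fits (suc E) s (k + E) × Fits (suc E) s (suc (k + E))
      fits = consecutive-fits {E} {gap n} {k} E≥1
        (subst (_≤ k * gap n) (m^2≡m*m E) lower)
        (subst (k * gap n ≤_) (trans (m^2≡m*m (a n)) (cong₂ _*_ aₙ≡1+E aₙ≡1+E)) upper)
        (subst (λ A → recip A <sup s) aₙ₊₁≡1+E+gap (proj₁ (b-tail (suc n))))
        (subst (λ A → sup s < recip (A ∸ 1)) aₙ₊₁≡1+E+gap (tail-sup-< (suc n)))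
      fit-at : ∀ c → Fits (suc E) s c → Fits (a n) s c
      fit-at c = subst (λ A → Fits A s c) (sym aₙ≡1+E)

    gap≢1 : ∀ n → gap n ≢ 1
    gap≢1 n gap≡1 = no-multiple-in-window n (a n ^ 2)
      (subst ((a n ∸ 1) ^ 2 ≤_) (sym aₙ²*gap≡aₙ²) (^-monoˡ-≤ 2 (m∸n≤m (a n) 1)))
      (≤-reflexive aₙ²*gap≡aₙ²)
      where
      aₙ²*gap≡aₙ² : a n ^ 2 * gap n ≡ a n ^ 2
      aₙ²*gap≡aₙ² = trans (cong (a n ^ 2 *_) gap≡1) (*-identityʳ (a n ^ 2))

    a+2≤a-suc : ∀ n → a n + 2 ≤ a (suc n)
    a+2≤a-suc n = subst (a n + 2 ≤_) (sym (a-suc≡a+gap n))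
      (+-monoʳ-≤ (a n) (≤∧≢⇒< (m<n⇒0<n∸m (a-strictly-increasing n)) (gap≢1 n ∘ sym)))

    a*a-suc≡a*gap+a*a : ∀ n → a n * a (suc n) ≡ a n * gap n + a n * a n
    a*a-suc≡a*gap+a*a n = begin
      a n * a (suc n)          ≡⟨ cong (a n *_) (a-suc≡a+gap n) ⟩
      a n * (a n + gap n)      ≡⟨ *-distribˡ-+ (a n) (a n) (gap n) ⟩
      a n * a n + a n * gap n  ≡⟨ +-comm (a n * a n) (a n * gap n) ⟩
      a n * gap n + a n * a n  ∎
      where open ≡-Reasoning

    gap∤a*a-suc : ∀ n → ¬ (gap n ∣ a n * a (suc n))
    gap∤a*a-suc n gap∣aₙaₙ₊₁
      with ∣m+n∣m⇒∣n (subst (gap n ∣_) (a*a-suc≡a*gap+a*a n) gap∣aₙaₙ₊₁) (n∣m*n (a n))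
    ... | divides q aₙaₙ≡q*gap = no-multiple-in-window n q
      (subst ((a n ∸ 1) ^ 2 ≤_) aₙ²≡q*gap (^-monoˡ-≤ 2 (m∸n≤m (a n) 1))) (≤-reflexive (sym aₙ²≡q*gap))
      where
      aₙ²≡q*gap : a n ^ 2 ≡ q * gap n
      aₙ²≡q*gap = trans (m^2≡m*m (a n)) aₙaₙ≡q*gap

    fdiv-gap-< : ∀ n → fdiv (a n ^ 2) (gap n) * gap n < (a n ∸ 1) ^ 2
    fdiv-gap-< n = decidable-stable (_ <? _) λ ≮ →
      no-multiple-in-window n (fdiv (a n ^ 2) (gap n)) (≮⇒≥ ≮) (fdiv-*-≤ (a n ^ 2) (gap n))

-- Positivity of a follows from 2 ≤ a 0 and monotonicity.
proposition5 : (a : ℕ → ℕ)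
    → (∀ n → 1 ≤ a n)
    → (∀ n → a n ≤ a (suc n))
    → 2 ≤ a 0
    → (∀ M → ∃ λ n → M ≤ a n)
    → (∃ λ b → Admissible a b × (∀ b′ → Admissible a b′ → ∀ i → b′ i ≡ b i))
    → ∀ n → (a n + 2 ≤ a (suc n))
            × (¬ ((a (suc n) ∸ a n) ∣ (a n * a (suc n))))
            × (fdiv (a n ^ 2) (a (suc n) ∸ a n) * (a (suc n) ∸ a n) < (a n ∸ 1) ^ 2)
proposition5 a _ a-mono a₀≥2 _ (b , adm , unique) n = a+2≤a-suc n , gap∤a*a-suc n , fdiv-gap-< n
  where
  a≥2 : ∀ n → 2 ≤ a n
  a≥2 zero    = a₀≥2
  a≥2 (suc n) = ≤-trans (a≥2 n) (a-mono n)
  open Realisations a a≥2 a-mono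
  open UniqueExpansion b adm unique
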